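{- Let $n \geq 2$ and $s \geq 1$ be integers and let $$f(x) = -1 + x + x^{n} + x^{m_1} + \cdots + x^{m_s},$$ where $m_1 - n \geq n-1$ and $m_{j+1} - m_j \geq n-1$ for $1 \leq j < s$. If $\Phi_p(x)$ divides $f(x)$ for some prime number $p$, then $p$ divides $s+1$.
   Context: $\Phi_p(x) = 1 + x + \cdots + x^{p-1}$ denotes the $p$-th cyclotomic polynomial. -}

module Defs where

open import Data.Nat using (ℕ; zero; suc)
open import Data.Integer using (ℤ; +_; -[1+_]) renaming (_+_ to _+ℤ_; _*_ to _*ℤ_)
open import Data.List using (List; []; _∷_; map; replicate; _++_)
open import Data.Product using (∃)
open import Relation.Binary.PropositionalEquality using (_≡_)

-- Polynomials in ℤ[x] as coefficient lists, lowest degree first.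
-- Trailing zeros are allowed; equality of polynomials is coefficientwise.
Poly : Set
Poly = List ℤ

coeff : Poly → ℕ → ℤ
coeff []       _       = + 0
coeff (a ∷ _)  zero    = a
coeff (_ ∷ p)  (suc k) = coeff p k

infixl 6 _+P_
infixl 7 _*P_

_+P_ : Poly → Poly → Poly
[]      +P q       = q
(a ∷ p) +P []      = a ∷ p
(a ∷ p) +P (b ∷ q) = (a +ℤ b) ∷ (p +P q)

_*P_ : Poly → Poly → Poly
[]      *P q = []
(a ∷ p) *P q = map (a *ℤ_) q +P (+ 0 ∷ (p *P q))

monomial : ℤ → ℕ → Poly
monomial c k = replicate k (+ 0) ++ (c ∷ [])

_∣P_ : Poly → Poly → Set
g ∣P f = ∃ λ q → ∀ k → coeff (g *P q) k ≡ coeff f k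

-- p-th cyclotomic polynomial (p prime): 1 + x + ... + x^(p-1)
Φ : ℕ → Poly
Φ p = replicate p (+ 1)

sumMonos : (ℕ → ℕ) → ℕ → Poly
sumMonos m zero    = []
sumMonos m (suc j) = sumMonos m j +P monomial (+ 1) (m j)

-- f(x) = -1 + x + x^n + x^(m_1) + ... + x^(m_s), with m_i written m (i-1)
fPoly : ℕ → ℕ → (ℕ → ℕ) → Poly
fPoly n s m = monomial -[1+ 0 ] 0 +P monomial (+ 1) 1 +P monomial (+ 1) n +P sumMonos m s

module Submission where

-- Evaluation at x = 1, i.e. taking the sum of all coefficients,
-- is a ring homomorphism ℤ[x] → ℤ.  Hence a divisibility  g ∣ f  in ℤ[x]
-- becomes a divisibility  g(1) ∣ f(1)  in ℤ.  For the cyclotomic polynomial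
-- Φ_p(1) = p, and for f(x) = -1 + x + x^n + x^(m_1) + ... + x^(m_s) we get
-- f(1) = -1 + 1 + 1 + s = s + 1, so  Φ_p ∣ f  forces  p ∣ s + 1.

open import Defs
open import Data.Nat using (ℕ; zero; suc; _+_; _∸_; _≤_; _<_)
open import Data.Nat.Divisibility using (_∣_)
open import Data.Nat.Primality using (Prime)
open import Data.Integer using (ℤ; +_; -[1+_]) renaming (_+_ to _+ℤ_; _*_ to _*ℤ_)
import Data.Integer.Properties as ℤ
import Data.Integer.Divisibility.Signed as ℤ∣
open import Algebra.Properties.CommutativeSemigroup ℤ.+-commutativeSemigroup using (interchange)
open import Data.List using ([]; _∷_; map)
open import Data.Product using (_,_)
open import Relation.Binary.PropositionalEquality using (_≡_; refl; sym; trans; cong; cong₂; subst₂; module ≡-Reasoning)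

eval₁ : Poly → ℤ
eval₁ []      = + 0
eval₁ (a ∷ p) = a +ℤ eval₁ p

eval₁-+P : ∀ p q → eval₁ (p +P q) ≡ eval₁ p +ℤ eval₁ q
eval₁-+P []      q       = sym (ℤ.+-identityˡ (eval₁ q))
eval₁-+P (a ∷ p) []      = sym (ℤ.+-identityʳ (eval₁ (a ∷ p)))
eval₁-+P (a ∷ p) (b ∷ q) = begin
  (a +ℤ b) +ℤ eval₁ (p +P q)          ≡⟨ cong ((a +ℤ b) +ℤ_) (eval₁-+P p q) ⟩
  (a +ℤ b) +ℤ (eval₁ p +ℤ eval₁ q)    ≡⟨ interchange a b (eval₁ p) (eval₁ q) ⟩
  (a +ℤ eval₁ p) +ℤ (b +ℤ eval₁ q)    ∎
  where open ≡-Reasoning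

eval₁-scale : ∀ a q → eval₁ (map (a *ℤ_) q) ≡ a *ℤ eval₁ q
eval₁-scale a []      = sym (ℤ.*-zeroʳ a)
eval₁-scale a (b ∷ q) = begin
  a *ℤ b +ℤ eval₁ (map (a *ℤ_) q)   ≡⟨ cong (a *ℤ b +ℤ_) (eval₁-scale a q) ⟩
  a *ℤ b +ℤ a *ℤ eval₁ q            ≡⟨ ℤ.*-distribˡ-+ a b (eval₁ q) ⟨
  a *ℤ (b +ℤ eval₁ q)               ∎
  where open ≡-Reasoning

eval₁-*P : ∀ p q → eval₁ (p *P q) ≡ eval₁ p *ℤ eval₁ q
eval₁-*P []      q = refl
eval₁-*P (a ∷ p) q = begin
  eval₁ (map (a *ℤ_) q +P (+ 0 ∷ p *P q))          ≡⟨ eval₁-+P (map (a *ℤ_) q) (+ 0 ∷ p *P q) ⟩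
  eval₁ (map (a *ℤ_) q) +ℤ (+ 0 +ℤ eval₁ (p *P q)) ≡⟨ cong₂ _+ℤ_ (eval₁-scale a q) shifted ⟩
  a *ℤ eval₁ q +ℤ eval₁ p *ℤ eval₁ q               ≡⟨ ℤ.*-distribʳ-+ (eval₁ q) a (eval₁ p) ⟨
  (a +ℤ eval₁ p) *ℤ eval₁ q                        ∎
  where
  open ≡-Reasoning
  -- multiplying by x (prepending a zero) does not change the value at 1
  shifted : + 0 +ℤ eval₁ (p *P q) ≡ eval₁ p *ℤ eval₁ q
  shifted = trans (ℤ.+-identityˡ (eval₁ (p *P q))) (eval₁-*P p q)

-- Polynomials with the same coefficients (possibly differing in trailing
-- zeros) have the same value at 1, so evaluation is well defined on ℤ[x].
eval₁-coeff : ∀ f g → (∀ k → coeff f k ≡ coeff g k) → eval₁ f ≡ eval₁ g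
eval₁-coeff []      []      same = refl
eval₁-coeff []      (b ∷ g) same = cong₂ _+ℤ_ (same 0) (eval₁-coeff [] g (λ k → same (suc k)))
eval₁-coeff (a ∷ f) []      same = cong₂ _+ℤ_ (same 0) (eval₁-coeff f [] (λ k → same (suc k)))
eval₁-coeff (a ∷ f) (b ∷ g) same = cong₂ _+ℤ_ (same 0) (eval₁-coeff f g (λ k → same (suc k)))

eval₁-∣P : ∀ g f → g ∣P f → eval₁ g ℤ∣.∣ eval₁ f
eval₁-∣P g f (q , g*q≡f) = ℤ∣.divides (eval₁ q) (begin
  eval₁ f              ≡⟨ eval₁-coeff (g *P q) f g*q≡f ⟨
  eval₁ (g *P q)       ≡⟨ eval₁-*P g q ⟩
  eval₁ g *ℤ eval₁ q   ≡⟨ ℤ.*-comm (eval₁ g) (eval₁ q) ⟩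
  eval₁ q *ℤ eval₁ g   ∎)
  where open ≡-Reasoning

eval₁-monomial : ∀ c k → eval₁ (monomial c k) ≡ c
eval₁-monomial c zero    = ℤ.+-identityʳ c
eval₁-monomial c (suc k) = trans (ℤ.+-identityˡ (eval₁ (monomial c k))) (eval₁-monomial c k)

eval₁-sumMonos : ∀ m j → eval₁ (sumMonos m j) ≡ + j
eval₁-sumMonos m zero    = refl
eval₁-sumMonos m (suc j) = begin
  eval₁ (sumMonos m j +P monomial (+ 1) (m j))       ≡⟨ eval₁-+P (sumMonos m j) (monomial (+ 1) (m j)) ⟩
  eval₁ (sumMonos m j) +ℤ eval₁ (monomial (+ 1) (m j)) ≡⟨ cong₂ _+ℤ_ (eval₁-sumMonos m j) (eval₁-monomial (+ 1) (m j)) ⟩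
  + j +ℤ + 1                                         ≡⟨ ℤ.+-comm (+ j) (+ 1) ⟩
  + suc j                                            ∎
  where open ≡-Reasoning

eval₁-Φ : ∀ p → eval₁ (Φ p) ≡ + p
eval₁-Φ zero    = refl
eval₁-Φ (suc p) = cong (+ 1 +ℤ_) (eval₁-Φ p)

eval₁-fPoly : ∀ n s m → eval₁ (fPoly n s m) ≡ + suc s
eval₁-fPoly n s m = begin
  eval₁ (low +P x^n +P sumMonos m s)                   ≡⟨ eval₁-+P (low +P x^n) (sumMonos m s) ⟩
  eval₁ (low +P x^n) +ℤ eval₁ (sumMonos m s)           ≡⟨ cong (_+ℤ eval₁ (sumMonos m s)) (eval₁-+P low x^n) ⟩
  (eval₁ low +ℤ eval₁ x^n) +ℤ eval₁ (sumMonos m s)     ≡⟨ cong₂ (λ u v → (u +ℤ eval₁ x^n) +ℤ v) low≡0 (eval₁-sumMonos m s) ⟩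
  (+ 0 +ℤ eval₁ x^n) +ℤ + s                            ≡⟨ cong (λ v → (+ 0 +ℤ v) +ℤ + s) (eval₁-monomial (+ 1) n) ⟩
  + suc s                                              ∎
  where
  open ≡-Reasoning
  low x^n : Poly
  low = monomial -[1+ 0 ] 0 +P monomial (+ 1) 1
  x^n = monomial (+ 1) n
  low≡0 : eval₁ low ≡ + 0
  low≡0 = trans (eval₁-+P (monomial -[1+ 0 ] 0) (monomial (+ 1) 1))
                (cong₂ _+ℤ_ (eval₁-monomial -[1+ 0 ] 0) (eval₁-monomial (+ 1) 1))

mainTheorem4 : (n s : ℕ) → (m : ℕ → ℕ) → 2 ≤ n → 1 ≤ s
    → n + (n ∸ 1) ≤ m 0
    → (∀ j → suc j < s → m j + (n ∸ 1) ≤ m (suc j))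
    → (p : ℕ) → Prime p → Φ p ∣P fPoly n s m → p ∣ suc s
mainTheorem4 n s m _ _ _ _ p _ Φp∣f = ℤ∣.∣⇒∣ᵤ p∣s+1
  where
  Φ₁∣f₁ : eval₁ (Φ p) ℤ∣.∣ eval₁ (fPoly n s m)
  Φ₁∣f₁ = eval₁-∣P (Φ p) (fPoly n s m) Φp∣f
  p∣s+1 : + p ℤ∣.∣ + suc s
  p∣s+1 = subst₂ ℤ∣._∣_ (eval₁-Φ p) (eval₁-fPoly n s m) Φ₁∣f₁
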